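{- Let $l {\,\simeq\,} r \lor C$ and $L[t] \lor D$ be clauses of first-order logic with equality, where $l,r$ are terms, $C$ and $D$ are clauses, and $L[t]$ is a literal containing a particular occurrence of the term $t$. Let $\sigma$ be a substitution such that (1) $l\sigma = t$, (2) $C\sigma \subseteq_M D$, (3) $l\sigma \succ r\sigma$, and (4) $L[t] \lor D \succ (l {\,\simeq\,} r)\sigma \lor C\sigma$. Then subsumption demodulation $$\frac{l {\,\simeq\,} r \lor C \qquad L[t] \lor D}{L[r\sigma] \lor D}$$ is a simplification inference whose main premise $L[t]\lor D$ becomes redundant: $L[t] \lor D$ is a logical consequence of $L[r\sigma] \lor D$ and $l {\,\simeq\,} r \lor C$ (via its instance $(l {\,\simeq\,} r)\sigma \lor C\sigma$), and $L[t]\lor D$ is strictly greater w.r.t. $\succ$ than both $L[r\sigma] \lor D$ and $(l {\,\simeq\,} r)\sigma \lor C\sigma$.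
   Context: Clauses are finite multisets of literals, read as disjunctions with variables implicitly universally quantified; $\subseteq_M$ denotes multiset inclusion. For an expression $E$, $E[s]$ denotes $E$ with a particular occurrence of a term $s$, and $E[s']$ denotes the result of replacing that occurrence by $s'$. $E\sigma$ denotes the result of applying substitution $\sigma$. The symbol $\succ$ is a fixed simplification ordering on terms (a well-founded strict partial order that is stable under substitutions, monotonic w.r.t. term contexts, and has the subterm property), extended to literals and clauses via the multiset extension; on literals, a negative literal is greater than its positive counterpart, if $L_1 \succ L_2$ for positive $L_1,L_2$ then $\neg L_1 \succ L_1 \succ \neg L_2 \succ L_2$, and equality literals are smaller than any literal with a predicate symbol other than equality. A clause $C$ is redundant in a set $S$ of clauses if there are clauses $C_1,\dots,C_n$ (from $S$) with $C \succ C_i$ for all $i$ and $C_1,\dots,C_n \models C$. A simplification inference is one in which a premise (the main premise) becomes redundant once the conclusion is added. -}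

module Defs where

open import Data.Nat using (ℕ)
open import Data.Fin using (Fin)
open import Data.Vec as V using (Vec; lookup; _[_]≔_)
open import Data.List using (List; []; _∷_; _++_; map)
open import Data.List.Relation.Unary.Any using (Any)
open import Data.List.Relation.Unary.All using (All)
open import Data.List.Membership.Propositional using (_∈_)
open import Data.List.Relation.Binary.Permutation.Propositional using (_↭_)
open import Data.Product using (Σ; ∃; _×_; proj₂)
open import Data.Sum using (_⊎_)
open import Data.Empty using (⊥)
open import Data.Unit using (⊤)
open import Relation.Binary.PropositionalEquality using (_≡_; _≢_)
open import Relation.Nullary using (¬_)
open import Induction.WellFounded using (WellFounded)

-- Multisets are represented by lists up to permutation (_↭_).

module _ {A : Set} where

  _⊆M_ : List A → List A → Set
  X ⊆M Y = ∃ λ R → Y ↭ (X ++ R)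

  MulExt : (A → A → Set) → List A → List A → Set
  MulExt _>_ M N =
    ∃ λ Z → ∃ λ X → ∃ λ Y →
      (M ↭ (Z ++ X)) × (N ↭ (Z ++ Y)) × (X ≢ []) ×
      (∀ y → y ∈ Y → ∃ λ x → (x ∈ X) × (x > y))

-- Terms are two-sorted: sort ι = ordinary terms, sort o = non-equality
-- atoms P(t₁,…,tₙ) (so that ≻ can compare predicate atoms as terms).

module FOL (Fun Pred : Set) (ar : Fun → ℕ) (par : Pred → ℕ) where

  data Sort : Set where
    ι o : Sort

  data Term : Sort → Set where
    var : ℕ → Term ι
    fun : (f : Fun) → Vec (Term ι) (ar f) → Term ι
    prd : (p : Pred) → Vec (Term ι) (par p) → Term o

  Subst : Set
  Subst = ℕ → Term ι

  mutual
    _⟨_⟩ : ∀ {k} → Term k → Subst → Term k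
    var x ⟨ σ ⟩ = σ x
    fun f ts ⟨ σ ⟩ = fun f (ts ⟨ σ ⟩*)
    prd p ts ⟨ σ ⟩ = prd p (ts ⟨ σ ⟩*)

    _⟨_⟩* : ∀ {n} → Vec (Term ι) n → Subst → Vec (Term ι) n
    V.[] ⟨ σ ⟩* = V.[]
    (t V.∷ ts) ⟨ σ ⟩* = (t ⟨ σ ⟩) V.∷ (ts ⟨ σ ⟩*)

  data Atom : Set where
    _≃_ : Term ι → Term ι → Atom
    pr  : Term o → Atom

  data Literal : Set where
    pos neg : Atom → Literal

  Clause : Set
  Clause = List Literal

  _⟨_⟩a : Atom → Subst → Atom
  (s ≃ t) ⟨ σ ⟩a = (s ⟨ σ ⟩) ≃ (t ⟨ σ ⟩)
  pr a ⟨ σ ⟩a = pr (a ⟨ σ ⟩)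

  _⟨_⟩l : Literal → Subst → Literal
  pos a ⟨ σ ⟩l = pos (a ⟨ σ ⟩a)
  neg a ⟨ σ ⟩l = neg (a ⟨ σ ⟩a)

  _⟨_⟩c : Clause → Subst → Clause
  C ⟨ σ ⟩c = map (λ L → L ⟨ σ ⟩l) C

  -- Replacement of one particular occurrence:
  -- Repl s s' E E'  means  E = E[s]  and  E' = E[s'] (same occurrence).

  data Repl (s s' : Term ι) : ∀ {k} → Term k → Term k → Set where
    here  : Repl s s' s s'
    inFun : ∀ f (ts : Vec (Term ι) (ar f)) i {u'} →
            Repl s s' (lookup ts i) u' →
            Repl s s' (fun f ts) (fun f (ts [ i ]≔ u'))
    inPrd : ∀ p (ts : Vec (Term ι) (par p)) i {u'} →
            Repl s s' (lookup ts i) u' →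
            Repl s s' (prd p ts) (prd p (ts [ i ]≔ u'))

  data AtomRepl (s s' : Term ι) : Atom → Atom → Set where
    left  : ∀ {u u' v} → Repl s s' u u' → AtomRepl s s' (u ≃ v) (u' ≃ v)
    right : ∀ {u v v'} → Repl s s' v v' → AtomRepl s s' (u ≃ v) (u ≃ v')
    inPr  : ∀ {a a'} → Repl s s' a a' → AtomRepl s s' (pr a) (pr a')

  data LitRepl (s s' : Term ι) : Literal → Literal → Set where
    pos : ∀ {a a'} → AtomRepl s s' a a' → LitRepl s s' (pos a) (pos a')
    neg : ∀ {a a'} → AtomRepl s s' a a' → LitRepl s s' (neg a) (neg a')

  record SimplificationOrdering : Set₁ where
    field
      _≻_      : ∀ {j k} → Term j → Term k → Set
      irrefl   : ∀ {k} {t : Term k} → ¬ (t ≻ t)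
      trans    : ∀ {i j k} {s : Term i} {t : Term j} {u : Term k} →
                 s ≻ t → t ≻ u → s ≻ u
      wf       : WellFounded (λ (a b : Σ Sort Term) → proj₂ b ≻ proj₂ a)
      stable   : ∀ {j k} {s : Term j} {t : Term k} (σ : Subst) →
                 s ≻ t → (s ⟨ σ ⟩) ≻ (t ⟨ σ ⟩)
      mono-fun : ∀ f (ts : Vec (Term ι) (ar f)) i {s t : Term ι} →
                 s ≻ t → fun f (ts [ i ]≔ s) ≻ fun f (ts [ i ]≔ t)
      mono-prd : ∀ p (ts : Vec (Term ι) (par p)) i {s t : Term ι} →
                 s ≻ t → prd p (ts [ i ]≔ s) ≻ prd p (ts [ i ]≔ t)
      sub-fun  : ∀ f (ts : Vec (Term ι) (ar f)) i → fun f ts ≻ lookup ts i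
      sub-prd  : ∀ p (ts : Vec (Term ι) (par p)) i → prd p ts ≻ lookup ts i

  module Ordered (ord : SimplificationOrdering) where
    open SimplificationOrdering ord

    _≻ι_ : Term ι → Term ι → Set
    s ≻ι t = s ≻ t

    _≻ₐ_ : Atom → Atom → Set
    (s ≃ t) ≻ₐ (u ≃ v) = MulExt _≻ι_ (s ∷ t ∷ []) (u ∷ v ∷ [])
    (s ≃ t) ≻ₐ pr b    = ⊥
    pr a    ≻ₐ (u ≃ v) = ⊤
    pr a    ≻ₐ pr b    = a ≻ b

    _≈ₐ_ : Atom → Atom → Set
    (s ≃ t) ≈ₐ (u ≃ v) = (s ∷ t ∷ []) ↭ (u ∷ v ∷ [])
    (s ≃ t) ≈ₐ pr b    = ⊥
    pr a    ≈ₐ (u ≃ v) = ⊥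
    pr a    ≈ₐ pr b    = a ≡ b

    -- literals: compare atoms first, and for the same atom the negative
    -- literal is greater; hence L₁ ≻ L₂ (positive) gives
    -- ¬L₁ ≻ L₁ ≻ ¬L₂ ≻ L₂.
    _≻ₗ_ : Literal → Literal → Set
    pos a ≻ₗ pos b = a ≻ₐ b
    neg a ≻ₗ neg b = a ≻ₐ b
    pos a ≻ₗ neg b = a ≻ₐ b
    neg a ≻ₗ pos b = (a ≻ₐ b) ⊎ (a ≈ₐ b)

    _≻c_ : Clause → Clause → Set
    C ≻c C' = MulExt _≻ₗ_ C C'

  record Interpretation : Set₁ where
    field
      Dom  : Set
      funI : (f : Fun) → Vec Dom (ar f) → Dom
      prdI : (p : Pred) → Vec Dom (par p) → Set

  module Sem (M : Interpretation) where
    open Interpretation M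

    mutual
      eval : (ℕ → Dom) → Term ι → Dom
      eval ν (var x) = ν x
      eval ν (fun f ts) = funI f (evals ν ts)

      evals : ∀ {n} → (ℕ → Dom) → Vec (Term ι) n → Vec Dom n
      evals ν V.[] = V.[]
      evals ν (t V.∷ ts) = eval ν t V.∷ evals ν ts

    ⟦_⟧a : Atom → (ℕ → Dom) → Set
    ⟦ s ≃ t ⟧a ν = eval ν s ≡ eval ν t
    ⟦ pr (prd p ts) ⟧a ν = prdI p (evals ν ts)

    ⟦_⟧l : Literal → (ℕ → Dom) → Set
    ⟦ pos a ⟧l ν = ⟦ a ⟧a ν
    ⟦ neg a ⟧l ν = ¬ ⟦ a ⟧a ν

    ⟦_⟧c : Clause → (ℕ → Dom) → Set
    ⟦ C ⟧c ν = Any (λ L → ⟦ L ⟧l ν) C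

  _⊨_ : Interpretation → Clause → Set
  M ⊨ C = ∀ ν → Sem.⟦_⟧c M C ν

  Entails : List Clause → Clause → Set₁
  Entails Cs C = ∀ M → All (λ Cᵢ → M ⊨ Cᵢ) Cs → M ⊨ C

module Submission where

-- In every model and valuation, either (lσ ≃ rσ) holds, and then L and L' = L[rσ]
-- have the same truth value because evaluation respects replacing an occurrence by
-- an equal term, or Cσ holds and is contained in D. For the ordering, monotonicity
-- of ≻ makes L[lσ] ≻ L[rσ], and replacing one literal of a clause by a smaller one
-- yields a smaller clause in the multiset extension.

open import Defs
open import Data.Nat using (ℕ)
open import Data.Fin using (Fin; zero; suc)
open import Data.Vec as V using (Vec; lookup; _[_]≔_)
open import Data.Vec.Properties using ([]≔-lookup)
open import Data.List using (List; []; _∷_; [_])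
open import Data.List.Relation.Unary.Any using (Any; here; there)
open import Data.List.Relation.Unary.Any.Properties using (++⁺ˡ)
open import Data.List.Relation.Unary.All using ([]; _∷_)
open import Data.List.Relation.Binary.Permutation.Propositional
  using (_↭_; ↭-refl; ↭-sym; ↭-trans; ↭-swap)
open import Data.List.Relation.Binary.Permutation.Propositional.Properties
  using (Any-resp-↭; ∷↭∷ʳ)
open import Data.Product using (_×_; _,_)
open import Function.Bundles using (_⇔_; mk⇔; module Equivalence)
open import Relation.Binary.PropositionalEquality using (_≡_; refl; sym; trans; cong; subst)

module _ {A : Set} where

  Any-resp-⊆M : ∀ {P : A → Set} {X Y} → X ⊆M Y → Any P X → Any P Y
  Any-resp-⊆M (_ , Y↭X++R) p = Any-resp-↭ (↭-sym Y↭X++R) (++⁺ˡ p)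

  MulExt-replace : ∀ {_>_ : A → A → Set} {M N x y} Z →
                   x > y → M ↭ x ∷ Z → N ↭ y ∷ Z → MulExt _>_ M N
  MulExt-replace {x = x} {y} Z x>y M↭ N↭ =
    Z , [ x ] , [ y ] , ↭-trans M↭ (∷↭∷ʳ x Z) , ↭-trans N↭ (∷↭∷ʳ y Z) , (λ ()) ,
    λ { _ (here refl) → x , here refl , x>y }

module _ {Fun Pred : Set} {ar : Fun → ℕ} {par : Pred → ℕ} where
  open FOL Fun Pred ar par

  module _ (ord : SimplificationOrdering) where
    open SimplificationOrdering ord
    open Ordered ord

    Repl⇒≻ : ∀ {s s' k} {u u' : Term k} → s ≻ s' → Repl s s' u u' → u ≻ u'
    Repl⇒≻ s≻s' here = s≻s'
    Repl⇒≻ s≻s' (inFun f ts i {u'} r) =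
      subst (λ ts' → fun f ts' ≻ fun f (ts [ i ]≔ u')) ([]≔-lookup ts i)
        (mono-fun f ts i (Repl⇒≻ s≻s' r))
    Repl⇒≻ s≻s' (inPrd p ts i {u'} r) =
      subst (λ ts' → prd p ts' ≻ prd p (ts [ i ]≔ u')) ([]≔-lookup ts i)
        (mono-prd p ts i (Repl⇒≻ s≻s' r))

    AtomRepl⇒≻ₐ : ∀ {s s' a a'} → s ≻ s' → AtomRepl s s' a a' → a ≻ₐ a'
    AtomRepl⇒≻ₐ s≻s' (left {v = v} r) =
      MulExt-replace [ v ] (Repl⇒≻ s≻s' r) ↭-refl ↭-refl
    AtomRepl⇒≻ₐ s≻s' (right {u = u} {v} {v'} r) =
      MulExt-replace [ u ] (Repl⇒≻ s≻s' r) (↭-swap u v ↭-refl) (↭-swap u v' ↭-refl)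
    AtomRepl⇒≻ₐ s≻s' (inPr r) = Repl⇒≻ s≻s' r

    LitRepl⇒≻ₗ : ∀ {s s' L L'} → s ≻ s' → LitRepl s s' L L' → L ≻ₗ L'
    LitRepl⇒≻ₗ s≻s' (pos r) = AtomRepl⇒≻ₐ s≻s' r
    LitRepl⇒≻ₗ s≻s' (neg r) = AtomRepl⇒≻ₐ s≻s' r

    LitRepl⇒≻c : ∀ {s s' L L'} (D : Clause) → s ≻ s' → LitRepl s s' L L' → (L ∷ D) ≻c (L' ∷ D)
    LitRepl⇒≻c D s≻s' r = MulExt-replace D (LitRepl⇒≻ₗ s≻s' r) ↭-refl ↭-refl

  module _ (M : Interpretation) where
    open Interpretation M
    open Sem M

    module _ {s s' : Term ι} (ν : ℕ → Dom) (s≡s' : eval ν s ≡ eval ν s') where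

      Repl-eval : ∀ {u u'} → Repl s s' u u' → eval ν u ≡ eval ν u'
      Repl-evals : ∀ {n} (ts : Vec (Term ι) n) i {u'} →
                   Repl s s' (lookup ts i) u' → evals ν ts ≡ evals ν (ts [ i ]≔ u')
      Repl-eval here = s≡s'
      Repl-eval (inFun f ts i r) = cong (funI f) (Repl-evals ts i r)
      Repl-evals (t V.∷ ts) zero r = cong (V._∷ evals ν ts) (Repl-eval r)
      Repl-evals (t V.∷ ts) (suc i) r = cong (eval ν t V.∷_) (Repl-evals ts i r)

      AtomRepl-⟦⟧ : ∀ {a a'} → AtomRepl s s' a a' → ⟦ a ⟧a ν ⇔ ⟦ a' ⟧a ν
      AtomRepl-⟦⟧ (left r) = mk⇔ (trans (sym (Repl-eval r))) (trans (Repl-eval r))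
      AtomRepl-⟦⟧ (right r) = mk⇔ (λ e → trans e (Repl-eval r)) (λ e → trans e (sym (Repl-eval r)))
      AtomRepl-⟦⟧ (inPr (inPrd p ts i r)) =
        mk⇔ (subst (prdI p) (Repl-evals ts i r)) (subst (prdI p) (sym (Repl-evals ts i r)))

      LitRepl-⟦⟧ : ∀ {L L'} → LitRepl s s' L L' → ⟦ L ⟧l ν ⇔ ⟦ L' ⟧l ν
      LitRepl-⟦⟧ (pos r) = AtomRepl-⟦⟧ r
      LitRepl-⟦⟧ (neg r) = mk⇔ (λ ¬a a' → ¬a (from a')) (λ ¬a' a → ¬a' (to a))
        where open Equivalence (AtomRepl-⟦⟧ r)

  demodulation-entails : ∀ {s s' L L'} {C D : Clause} → LitRepl s s' L L' → C ⊆M D →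
                         Entails ((L' ∷ D) ∷ (pos (s ≃ s') ∷ C) ∷ []) (L ∷ D)
  demodulation-entails r C⊆D M (⊨L'∨D ∷ ⊨s≃s'∨C ∷ []) ν with ⊨s≃s'∨C ν | ⊨L'∨D ν
  ... | there c  | _        = there (Any-resp-⊆M C⊆D c)
  ... | here s≡s' | here l' = here (Equivalence.from (LitRepl-⟦⟧ M ν s≡s' r) l')
  ... | here _   | there d  = there d

theorem2 : (Fun Pred : Set) (ar : Fun → ℕ) (par : Pred → ℕ) →
    let open FOL Fun Pred ar par in
    (ord : SimplificationOrdering) →
    let open SimplificationOrdering ord
        open Ordered ord in
    (l r : Term ι) (C D : Clause) (L L' : Literal) (t : Term ι) (σ : Subst) →
    LitRepl t (r ⟨ σ ⟩) L L' →
    l ⟨ σ ⟩ ≡ t →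
    (C ⟨ σ ⟩c) ⊆M D →
    (l ⟨ σ ⟩) ≻ (r ⟨ σ ⟩) →
    (L ∷ D) ≻c ((pos (l ≃ r) ∷ C) ⟨ σ ⟩c) →
    Entails ((L' ∷ D) ∷ ((pos (l ≃ r) ∷ C) ⟨ σ ⟩c) ∷ []) (L ∷ D)
      × ((L ∷ D) ≻c (L' ∷ D))
      × ((L ∷ D) ≻c ((pos (l ≃ r) ∷ C) ⟨ σ ⟩c))
theorem2 Fun Pred ar par ord l r C D L L' t σ repl refl Cσ⊆D lσ≻rσ L∨D≻premise =
  demodulation-entails repl Cσ⊆D , LitRepl⇒≻c ord D lσ≻rσ repl , L∨D≻premise
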